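{- Let $G$ be a graph, let $X$ be a partition parameter defined by property $x$, and let $\mathcal Y=\{Y_i\}_{i=1}^m$ be a partition of $V(G)$ having property $x$ with $|\mathcal Y|=X(G)$. Then the following are equivalent: (1) $\mathcal{TE}_X(G)\cong K_{|Y_1|}\,\square\,\cdots\,\square\,K_{|Y_m|}$; (2) $\mathcal{TS}_X(G)\cong G[Y_1]\,\square\,\cdots\,\square\,G[Y_m]$; (3) $\mathcal Y$ is the unique partition of $V(G)$ having property $x$ such that $|\mathcal Y|=X(G)$. Here $\square$ denotes the Cartesian product.
   Context: All graphs are finite and simple. A graph parameter $X$ is a partition parameter defined by a property $x$ of partitions of the vertex set if either for every graph $G$, $X(G)=\max\{|\mathcal Y|: \mathcal Y \text{ a partition of } V(G) \text{ with property } x\}$, or for every graph $G$, $X(G)=\min\{|\mathcal Y|: \mathcal Y \text{ a partition of } V(G) \text{ with property } x\}$. A set $B\subseteq V(G)$ is a transversal of a partition $\mathcal Y$ if $|Y\cap B|=1$ for each $Y\in\mathcal Y$. The reconfiguration graphs of $X$ are defined via transversals: $\mathcal{TE}_X(G)$ has vertex set the sets $B\subseteq V(G)$ with $|B|=X(G)$ that are transversals of some partition of $V(G)$ having property $x$; $S_1S_2$ is an edge iff there exist $v_1\in S_1\setminus S_2$, $v_2\in S_2\setminus S_1$ with $S_1\setminus\{v_1\}=S_2\setminus\{v_2\}$. $\mathcal{TS}_X(G)$ has the same vertex set, with $S_1S_2$ an edge iff such $v_1,v_2$ exist and $v_1v_2\in E(G)$. $G[Y]$ denotes the induced subgraph on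 $Y$. -}

module Defs where

open import Data.Nat using (ℕ; _≤_; _≥_)
open import Data.Fin using (Fin)
open import Data.Fin.Subset using (Subset; _∈_; _∉_; _-_; ∣_∣)
open import Data.Vec using (Vec; lookup)
open import Data.Product using (Σ; ∃; ∃-syntax; _×_; _,_)
open import Relation.Nullary using (¬_)
open import Relation.Binary.PropositionalEquality using (_≡_; _≢_)
open import Function.Bundles using (_⇔_)

record Graph : Set₁ where
  field
    n     : ℕ
    Adj   : Fin n → Fin n → Set
    sym   : ∀ {u v} → Adj u v → Adj v u
    irrefl : ∀ {u} → ¬ Adj u u

open Graph public

-- Equality of vertices is propositional equality on the carrier.

record PGraph : Set₁ where
  field
    Carrier : Set
    Vert    : Carrier → Set
    Edge    : Carrier → Carrier → Set

open PGraph public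

record _≅_ (H K : PGraph) : Set where
  field
    to      : Carrier H → Carrier K
    from    : Carrier K → Carrier H
    to-vert   : ∀ a → Vert H a → Vert K (to a)
    from-vert : ∀ b → Vert K b → Vert H (from b)
    from-to : ∀ a → Vert H a → from (to a) ≡ a
    to-from : ∀ b → Vert K b → to (from b) ≡ b
    edge    : ∀ a a' → Vert H a → Vert H a' → Edge H a a' ⇔ Edge K (to a) (to a')

-- Partitions of Fin n: labelled by Fin size, every label used
-- (so every block is nonempty).  |𝒴| = size.

record Partition (n : ℕ) : Set where
  field
    size  : ℕ
    label : Fin n → Fin size
    surj  : ∀ i → ∃[ v ] label v ≡ i

open Partition public

SameBlocks : ∀ {n} → Partition n → Partition n → Set
SameBlocks P Q = ∀ u v → (label P u ≡ label P v) ⇔ (label Q u ≡ label Q v)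

record PartitionProperty (G : Graph) : Set₁ where
  field
    holds    : Partition (n G) → Set
    respects : ∀ P Q → SameBlocks P Q → holds P → holds Q

open PartitionProperty public

-- Partition parameters are defined via max or min.
data MaxMin : Set where
  maxParam minParam : MaxMin

Optimal : ∀ {G} → MaxMin → PartitionProperty G → Partition (n G) → Set
Optimal maxParam x P = holds x P × (∀ Q → holds x Q → size Q ≤ size P)
Optimal minParam x P = holds x P × (∀ Q → holds x Q → size Q ≥ size P)

Transversal : ∀ {n} → Partition n → Subset n → Set
Transversal P B =
  (∀ i → ∃[ v ] (v ∈ B × label P v ≡ i)) ×
  (∀ u v → u ∈ B → v ∈ B → label P u ≡ label P v → u ≡ v)

TVert : (G : Graph) → PartitionProperty G → ℕ → Subset (n G) → Set
TVert G x k B = ∣ B ∣ ≡ k × ∃[ Q ] (holds x Q × Transversal Q B)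

TokenJump : ∀ {n} → Subset n → Subset n → Fin n → Fin n → Set
TokenJump S₁ S₂ v₁ v₂ =
  v₁ ∈ S₁ × v₁ ∉ S₂ × v₂ ∈ S₂ × v₂ ∉ S₁ × (S₁ - v₁) ≡ (S₂ - v₂)

TE : (G : Graph) → PartitionProperty G → ℕ → PGraph
TE G x k = record
  { Carrier = Subset (n G)
  ; Vert    = TVert G x k
  ; Edge    = λ S₁ S₂ → ∃[ v₁ ] ∃[ v₂ ] TokenJump S₁ S₂ v₁ v₂
  }

TS : (G : Graph) → PartitionProperty G → ℕ → PGraph
TS G x k = record
  { Carrier = Subset (n G)
  ; Vert    = TVert G x k
  ; Edge    = λ S₁ S₂ → ∃[ v₁ ] ∃[ v₂ ] (TokenJump S₁ S₂ v₁ v₂ × Adj G v₁ v₂)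
  }

-- H_i is given by its adjacency relation on Y_i.

BlockProduct : ∀ {n} (P : Partition n) →
               (Fin (size P) → Fin n → Fin n → Set) → PGraph
BlockProduct {n} P H = record
  { Carrier = Vec (Fin n) (size P)
  ; Vert    = λ t → ∀ i → label P (lookup t i) ≡ i
  ; Edge    = λ t s → ∃[ i ] (H i (lookup t i) (lookup s i) ×
                              (∀ j → j ≢ i → lookup t j ≡ lookup s j))
  }

-- K_{|Y_1|} □ ⋯ □ K_{|Y_m|}  (K_{|Y_i|} realised as the complete graph on Y_i)
ProdComplete : ∀ {n} → Partition n → PGraph
ProdComplete P = BlockProduct P (λ _ a b → a ≢ b)

ProdInduced : (G : Graph) → Partition (n G) → PGraph
ProdInduced G P = BlockProduct P (λ _ a b → Adj G a b)

UniqueOptimal : ∀ {G} → PartitionProperty G → Partition (n G) → Set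
UniqueOptimal x P = ∀ Q → holds x Q → size Q ≡ size P → SameBlocks Q P

-- Under uniqueness, every vertex of the reconfiguration graphs is a transversal of 𝒴: the
-- optimal partition it is a transversal of has X(G) blocks, hence the blocks of 𝒴. A transversal
-- of 𝒴 is the same thing as a choice vector (y₁, …, yₘ) with yᵢ ∈ Yᵢ, and exchanging one token
-- changes exactly one coordinate, along an edge of G[Yᵢ] for a slide. So the token-jump graph is
-- K_{|Y₁|} □ ⋯ □ K_{|Yₘ|} and the token-sliding graph is G[Y₁] □ ⋯ □ G[Yₘ].
--
-- Conversely, an isomorphism with either product injects the vertex set, which contains all
-- transversals of 𝒴, into the choice vectors, which are in bijection with those transversals;
-- by pigeonhole every vertex is a transversal of 𝒴. So every transversal of another optimal
-- partition 𝒬 is one of 𝒴, and comparing transversals through prescribed vertices shows that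
-- 𝒬 and 𝒴 have the same blocks.

module Submission where

open import Defs
open import Data.Bool using (true; false)
import Data.Bool as Bool
open import Data.Empty using (⊥; ⊥-elim)
open import Data.Fin using (Fin; zero; suc)
open import Data.Fin.Properties using (_≟_; any?; all?; suc-injective)
open import Data.Fin.Subset using (Subset; _─_; _-_; ⁅_⁆; _∈_; _∉_; _⊆_; ∣_∣)
open import Data.Fin.Subset.Properties using (_∈?_; ⊆-antisym; p─q⊆p; x∈p∧x≢y⇒x∈p-y; x∉⁅y⁆⇒x≢y)
open import Data.List using (List; []; _∷_; map; length; _++_; filter; allFin)
import Data.List as List
open import Data.List.Properties using (length-map; length-++; length-tabulate)
open import Data.List.Membership.Propositional using () renaming (_∈_ to _∈ₗ_)
import Data.List.Membership.DecPropositional as DecMembership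
open import Data.List.Membership.Propositional.Properties using (∈-∃++; ∈-++⁻; ∈-++⁺ˡ; ∈-++⁺ʳ; ∈-map⁺; ∈-map⁻; ∈-filter⁺; ∈-filter⁻; ∈-allFin; ∈-tabulate⁻)
open import Data.List.Relation.Binary.Subset.Propositional using () renaming (_⊆_ to _⊆ₗ_)
open import Data.List.Relation.Unary.Any using (here; there)
open import Data.List.Relation.Unary.All using ([])
import Data.List.Relation.Unary.All as All
import Data.List.Relation.Unary.All.Properties as All
open import Data.List.Relation.Unary.AllPairs using ([]; _∷_)
open import Data.List.Relation.Unary.Unique.Propositional using (Unique)
import Data.List.Relation.Unary.Unique.Propositional.Properties as Unique
open import Data.Nat using (zero; suc; _+_; _≤_; z≤n; s≤s)
open import Data.Nat.Properties using (≤-antisym; <-irrefl; +-suc; module ≤-Reasoning)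
open import Data.Product using (∃-syntax; _×_; _,_; proj₁; proj₂)
open import Data.Sum using (inj₁; inj₂)
open import Data.Vec using (Vec; []; _∷_; here; there; lookup; tabulate)
open import Data.Vec.Functional using (updateAt)
open import Data.Vec.Functional.Properties using (updateAt-updates; updateAt-minimal)
open import Data.Vec.Properties using (∷-injectiveʳ; ≡-dec; []=⇒lookup; lookup⇒[]=; lookup∘tabulate; tabulate∘lookup; tabulate-cong)
open import Function.Base using (_∘_; id)
open import Function.Bundles using (_⇔_; mk⇔; Equivalence)
open import Relation.Binary.Definitions using (DecidableEquality)
open import Relation.Binary.PropositionalEquality using (_≡_; _≢_; refl; cong; subst; subst₂; _≗_)
import Relation.Binary.PropositionalEquality as ≡
open import Relation.Nullary using (Dec; yes; no; does; ¬_)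
open import Relation.Nullary.Decidable using (dec-true; _×-dec_; _→-dec_)

InjectiveOn : {A B : Set} → (A → B) → (A → Set) → Set
InjectiveOn f V = ∀ {a b} → V a → V b → f a ≡ f b → a ≡ b

≅-injective : ∀ {Γ Δ} (iso : Γ ≅ Δ) → InjectiveOn (_≅_.to iso) (Vert Γ)
≅-injective iso {a} {b} a-vert b-vert ta≡tb =
  ≡.trans (≡.sym (from-to a a-vert)) (≡.trans (cong from ta≡tb) (from-to b b-vert))
  where open _≅_ iso

module _ {A : Set} where

  length-mono-⊆ : {xs ys : List A} → Unique xs → xs ⊆ₗ ys → length xs ≤ length ys
  length-mono-⊆ {[]} _ _ = z≤n
  length-mono-⊆ {x ∷ xs} (x∉xs ∷ xs!) x∷xs⊆ys
    with as , bs , refl ← ∈-∃++ (x∷xs⊆ys (here refl)) = begin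
      suc (length xs)             ≤⟨ s≤s (length-mono-⊆ xs! xs⊆as++bs) ⟩
      suc (length (as ++ bs))     ≡⟨ cong suc (length-++ as) ⟩
      suc (length as + length bs) ≡⟨ +-suc (length as) (length bs) ⟨
      length as + length (x ∷ bs) ≡⟨ length-++ as ⟨
      length (as ++ x ∷ bs)       ∎
    where
    open ≤-Reasoning
    xs⊆as++bs : xs ⊆ₗ as ++ bs
    xs⊆as++bs z∈xs with ∈-++⁻ as (x∷xs⊆ys (there z∈xs))
    ... | inj₁ z∈as         = ∈-++⁺ˡ z∈as
    ... | inj₂ (here refl)  = ⊥-elim (All.lookup x∉xs z∈xs refl)
    ... | inj₂ (there z∈bs) = ∈-++⁺ʳ as z∈bs

module _ {A B : Set} where

  map-Unique-on : (f : A → B) {xs : List A} → Unique xs → InjectiveOn f (_∈ₗ xs) → Unique (map f xs)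
  map-Unique-on f {[]} [] _ = []
  map-Unique-on f {x ∷ xs} (x∉xs ∷ xs!) f-inj =
    All.map⁺ (All.tabulate (λ y∈xs fx≡fy → All.lookup x∉xs y∈xs (f-inj (here refl) (there y∈xs) fx≡fy)))
    ∷ map-Unique-on f xs! (λ a∈ b∈ → f-inj (there a∈) (there b∈))

module _ {A : Set} (_≟ᴬ_ : DecidableEquality A) {f : A → A} {xs : List A} where

  open DecMembership _≟ᴬ_ using () renaming (_∈?_ to _∈ₗ?_)

  injectiveOn⇒surjectiveOn : Unique xs → (∀ {a} → a ∈ₗ xs → f a ∈ₗ xs) →
                             InjectiveOn f (_∈ₗ xs) → ∀ {b} → b ∈ₗ xs → b ∈ₗ map f xs
  injectiveOn⇒surjectiveOn xs! f-into f-inj {b} b∈xs with b ∈ₗ? map f xs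
  ... | yes b∈fxs = b∈fxs
  -- Otherwise b ∷ map f xs would be a duplicate-free sublist of xs longer than xs.
  ... | no  b∉fxs = ⊥-elim (<-irrefl refl
        (subst (λ m → suc m ≤ length xs) (length-map f xs) (length-mono-⊆ b∷fxs! b∷fxs⊆xs)))
    where
    b∷fxs! : Unique (b ∷ map f xs)
    b∷fxs! = All.tabulate (λ c∈fxs b≡c → b∉fxs (subst (_∈ₗ map f xs) (≡.sym b≡c) c∈fxs))
           ∷ map-Unique-on f xs! f-inj
    b∷fxs⊆xs : b ∷ map f xs ⊆ₗ xs
    b∷fxs⊆xs (here refl) = b∈xs
    b∷fxs⊆xs (there c∈fxs) with a , a∈xs , refl ← ∈-map⁻ f c∈fxs = f-into a∈xs

members : ∀ {n} → Subset n → List (Fin n)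
members []          = []
members (true  ∷ p) = zero ∷ map suc (members p)
members (false ∷ p) = map suc (members p)

length-members : ∀ {n} (p : Subset n) → length (members p) ≡ ∣ p ∣
length-members []          = refl
length-members (true  ∷ p) = cong suc (≡.trans (length-map suc (members p)) (length-members p))
length-members (false ∷ p) = ≡.trans (length-map suc (members p)) (length-members p)

members-Unique : ∀ {n} (p : Subset n) → Unique (members p)
members-Unique []          = []
members-Unique (true  ∷ p) = All.map⁺ (All.tabulate (λ _ ())) ∷ Unique.map⁺ suc-injective (members-Unique p)
members-Unique (false ∷ p) = Unique.map⁺ suc-injective (members-Unique p)

∈-members⁺ : ∀ {n} (p : Subset n) {v} → v ∈ p → v ∈ₗ members p
∈-members⁺ (true  ∷ p) here        = here refl
∈-members⁺ (true  ∷ p) (there v∈p) = there (∈-map⁺ suc (∈-members⁺ p v∈p))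
∈-members⁺ (false ∷ p) (there v∈p) = ∈-map⁺ suc (∈-members⁺ p v∈p)

∈-members⁻ : ∀ {n} (p : Subset n) {v} → v ∈ₗ members p → v ∈ p
∈-members⁻ (true  ∷ p) (here refl) = here
∈-members⁻ (true  ∷ p) (there v∈)
  with w , w∈ , refl ← ∈-map⁻ suc v∈ = there (∈-members⁻ p w∈)
∈-members⁻ (false ∷ p) v∈
  with w , w∈ , refl ← ∈-map⁻ suc v∈ = there (∈-members⁻ p w∈)

allSubsets : ∀ n → List (Subset n)
allSubsets zero    = [] ∷ []
allSubsets (suc n) = map (true ∷_) (allSubsets n) ++ map (false ∷_) (allSubsets n)

∈-allSubsets : ∀ {n} (p : Subset n) → p ∈ₗ allSubsets n
∈-allSubsets []          = here refl
∈-allSubsets (true  ∷ p) = ∈-++⁺ˡ (∈-map⁺ (true ∷_) (∈-allSubsets p))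
∈-allSubsets (false ∷ p) = ∈-++⁺ʳ (map (true ∷_) (allSubsets _)) (∈-map⁺ (false ∷_) (∈-allSubsets p))

allSubsets-Unique : ∀ n → Unique (allSubsets n)
allSubsets-Unique zero    = [] ∷ []
allSubsets-Unique (suc n) = Unique.++⁺ (Unique.map⁺ ∷-injectiveʳ (allSubsets-Unique n))
                                       (Unique.map⁺ ∷-injectiveʳ (allSubsets-Unique n))
                                       inside≢outside
  where
  inside≢outside : ∀ {p} → p ∈ₗ map (true ∷_) (allSubsets n) × p ∈ₗ map (false ∷_) (allSubsets n) → ⊥
  inside≢outside (p∈₁ , p∈₂) with _ , _ , refl ← ∈-map⁻ _ p∈₁ with _ , _ , () ← ∈-map⁻ _ p∈₂

x∈p-y⇒x≢y : ∀ {n} {p : Subset n} {x y} → x ∈ p - y → x ≢ y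
x∈p-y⇒x≢y {p = p} {y = y} = x∉⁅y⁆⇒x≢y ∘ x∈p─q⇒x∉q p ⁅ y ⁆
  where
  x∈p─q⇒x∉q : ∀ {n} (p q : Subset n) {x} → x ∈ p ─ q → x ∉ q
  x∈p─q⇒x∉q (_ ∷ p) (_ ∷ q) (there x∈) (there x∈q) = x∈p─q⇒x∉q p q x∈ x∈q

x∈p-y⇒x∈p : ∀ {n} {p : Subset n} {x y} → x ∈ p - y → x ∈ p
x∈p-y⇒x∈p {p = p} {y = y} = p─q⊆p p ⁅ y ⁆

AgreeOff : ∀ {m} {A : Set} → (Fin m → A) → (Fin m → A) → Fin m → Set
AgreeOff σ τ i = ∀ j → j ≢ i → σ j ≡ τ j

module _ {n} (Q : Partition n) where

  IsSection : (Fin (size Q) → Fin n) → Set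
  IsSection σ = ∀ i → label Q (σ i) ≡ i

  -- v ∈ image σ iff v is σ's choice for its own block; for a section this is the range of σ.
  image : (Fin (size Q) → Fin n) → Subset n
  image σ = tabulate (λ v → does (σ (label Q v) ≟ v))

  ∈-image⁺ : ∀ σ {v} → σ (label Q v) ≡ v → v ∈ image σ
  ∈-image⁺ σ {v} eq = lookup⇒[]= v _ (≡.trans (lookup∘tabulate _ v) (dec-true (σ (label Q v) ≟ v) eq))

  ∈-image⁻ : ∀ σ {v} → v ∈ image σ → σ (label Q v) ≡ v
  ∈-image⁻ σ {v} v∈ with σ (label Q v) ≟ v | ≡.trans (≡.sym (lookup∘tabulate _ v)) ([]=⇒lookup v∈)
  ... | yes σv≡v | _ = σv≡v
  ... | no  _    | ()

  image-cong : ∀ {σ τ} → σ ≗ τ → image σ ≡ image τ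
  image-cong σ≗τ = tabulate-cong (λ v → cong (λ w → does (w ≟ v)) (σ≗τ (label Q v)))

  section∈image : ∀ {σ} → IsSection σ → ∀ i → σ i ∈ image σ
  section∈image {σ} σ-sec i = ∈-image⁺ σ (cong σ (σ-sec i))

  image-transversal : ∀ {σ} → IsSection σ → Transversal Q (image σ)
  image-transversal {σ} σ-sec =
    (λ i → σ i , section∈image σ-sec i , σ-sec i) ,
    (λ u v u∈ v∈ lu≡lv → ≡.trans (≡.sym (∈-image⁻ σ u∈)) (≡.trans (cong σ lu≡lv) (∈-image⁻ σ v∈)))

  image-minus-⊆ : ∀ {σ τ} → IsSection τ → ∀ i → AgreeOff σ τ i → image σ - σ i ⊆ image τ - τ i
  image-minus-⊆ {σ} {τ} τ-sec i agree {w} w∈ = x∈p∧x≢y⇒x∈p-y (∈-image⁺ τ τw≡w) w≢τi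
    where
    σw≡w = ∈-image⁻ σ (x∈p-y⇒x∈p w∈)
    Qw≢i : label Q w ≢ i
    Qw≢i Qw≡i = x∈p-y⇒x≢y w∈ (≡.trans (≡.sym σw≡w) (cong σ Qw≡i))
    τw≡w = ≡.trans (≡.sym (agree _ Qw≢i)) σw≡w
    w≢τi : w ≢ τ i
    w≢τi w≡τi = Qw≢i (≡.trans (cong (label Q) w≡τi) (τ-sec i))

  -- A junk vertex of block i when B misses that block.
  representative : Subset n → Fin (size Q) → Fin n
  representative B i with any? (λ v → (v ∈? B) ×-dec (label Q v ≟ i))
  ... | yes (v , _) = v
  ... | no  _       = proj₁ (surj Q i)

  representative-spec : ∀ {B} → Transversal Q B → ∀ i →
                        representative B i ∈ B × label Q (representative B i) ≡ i
  representative-spec {B} (cover , _) i with any? (λ v → (v ∈? B) ×-dec (label Q v ≟ i))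
  ... | yes (_ , spec) = spec
  ... | no  none       = ⊥-elim (none (cover i))

  representative-section : ∀ {B} → Transversal Q B → IsSection (representative B)
  representative-section B-tr = proj₂ ∘ representative-spec B-tr

  image-representative : ∀ {B} → Transversal Q B → image (representative B) ≡ B
  image-representative {B} B-tr@(_ , single) = ⊆-antisym image⊆B B⊆image
    where
    image⊆B : image (representative B) ⊆ B
    image⊆B {v} v∈ = subst (_∈ B) (∈-image⁻ (representative B) v∈) (proj₁ (representative-spec B-tr (label Q v)))
    B⊆image : B ⊆ image (representative B)
    B⊆image {v} v∈B = ∈-image⁺ (representative B) (single _ _ r∈B v∈B lr≡lv)
      where
      r∈B = proj₁ (representative-spec B-tr (label Q v))
      lr≡lv = proj₂ (representative-spec B-tr (label Q v))

  representative-image : ∀ {σ} → IsSection σ → representative (image σ) ≗ σ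
  representative-image {σ} σ-sec i
    with r∈ , lr≡i ← representative-spec (image-transversal σ-sec) i
    = ≡.trans (≡.sym (∈-image⁻ σ r∈)) (cong σ lr≡i)

  representatives : Subset n → Vec (Fin n) (size Q)
  representatives B = tabulate (representative B)

  representatives-section : ∀ {B} → Transversal Q B → IsSection (lookup (representatives B))
  representatives-section {B} B-tr i =
    ≡.trans (cong (label Q) (lookup∘tabulate (representative B) i)) (representative-section B-tr i)

  image-representatives : ∀ {B} → Transversal Q B → image (lookup (representatives B)) ≡ B
  image-representatives {B} B-tr =
    ≡.trans (image-cong (lookup∘tabulate (representative B))) (image-representative B-tr)

  representatives-image : ∀ {t} → IsSection (lookup t) → representatives (image (lookup t)) ≡ t
  representatives-image {t} t-sec = ≡.trans (tabulate-cong (representative-image t-sec)) (tabulate∘lookup t)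

  sameBlocks-transversal : ∀ P {B} → SameBlocks Q P → Transversal Q B → Transversal P B
  sameBlocks-transversal P {B} Q~P (cover , single) = coverP , singleP
    where
    coverP : ∀ i → ∃[ v ] (v ∈ B × label P v ≡ i)
    coverP i with w , lw≡i ← surj P i with v , v∈B , lv≡lw ← cover (label Q w) =
      v , v∈B , ≡.trans (Equivalence.to (Q~P v w) lv≡lw) lw≡i
    singleP : ∀ u v → u ∈ B → v ∈ B → label P u ≡ label P v → u ≡ v
    singleP u v u∈B v∈B lu≡lv = single u v u∈B v∈B (Equivalence.from (Q~P u v) lu≡lv)

  section-through : (Fin (size Q) → Fin n) → Fin n → Fin (size Q) → Fin n
  section-through σ a = updateAt σ (label Q a) (λ _ → a)

  section-through-at : ∀ σ a → section-through σ a (label Q a) ≡ a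
  section-through-at σ a = updateAt-updates (label Q a) σ

  section-through-off : ∀ σ a {i} → i ≢ label Q a → section-through σ a i ≡ σ i
  section-through-off σ a {i} = updateAt-minimal i (label Q a) σ

  section-through-section : ∀ {σ} → IsSection σ → ∀ a → IsSection (section-through σ a)
  section-through-section {σ} σ-sec a i with i ≟ label Q a
  ... | yes refl = cong (label Q) (section-through-at σ a)
  ... | no  i≢la = ≡.trans (cong (label Q) (section-through-off σ a i≢la)) (σ-sec i)

  some-section : Fin (size Q) → Fin n
  some-section = proj₁ ∘ surj Q

  some-section-section : IsSection some-section
  some-section-section = proj₂ ∘ surj Q

  transversal? : ∀ B → Dec (Transversal Q B)
  transversal? B =
    all? (λ i → any? (λ v → (v ∈? B) ×-dec (label Q v ≟ i))) ×-dec
    all? (λ u → all? (λ v → (u ∈? B) →-dec ((v ∈? B) →-dec ((label Q u ≟ label Q v) →-dec (u ≟ v)))))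

  transversals : List (Subset n)
  transversals = filter transversal? (allSubsets n)

  transversals-Unique : Unique transversals
  transversals-Unique = Unique.filter⁺ transversal? (allSubsets-Unique n)

  ∈-transversals⁺ : ∀ {B} → Transversal Q B → B ∈ₗ transversals
  ∈-transversals⁺ {B} = ∈-filter⁺ transversal? (∈-allSubsets B)

  ∈-transversals⁻ : ∀ {B} → B ∈ₗ transversals → Transversal Q B
  ∈-transversals⁻ = proj₂ ∘ ∈-filter⁻ transversal? {xs = allSubsets n}

  transversal-size : ∀ {B} → Transversal Q B → ∣ B ∣ ≡ size Q
  transversal-size {B} B-tr@(_ , single) = ≤-antisym |B|≤|Q| |Q|≤|B|
    where
    open ≤-Reasoning
    |B|≤|Q| : ∣ B ∣ ≤ size Q
    |B|≤|Q| = begin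
      ∣ B ∣                              ≡⟨ length-members B ⟨
      length (members B)                 ≡⟨ length-map (label Q) (members B) ⟨
      length (map (label Q) (members B)) ≤⟨ length-mono-⊆ labels! (λ _ → ∈-allFin _) ⟩
      length (allFin (size Q))           ≡⟨ length-tabulate id ⟩
      size Q                             ∎
      where
      labels! = map-Unique-on (label Q) (members-Unique B)
                  (λ u∈ v∈ → single _ _ (∈-members⁻ B u∈) (∈-members⁻ B v∈))
    |Q|≤|B| : size Q ≤ ∣ B ∣
    |Q|≤|B| = begin
      size Q                                    ≡⟨ length-tabulate (representative B) ⟨
      length (List.tabulate (representative B)) ≤⟨ length-mono-⊆ reps! reps⊆B ⟩
      length (members B)                        ≡⟨ length-members B ⟩
      ∣ B ∣                                     ∎
      where
      reps! = Unique.tabulate⁺ (λ {i} {j} ri≡rj → ≡.trans (≡.sym (representative-section B-tr i))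
                (≡.trans (cong (label Q) ri≡rj) (representative-section B-tr j)))
      reps⊆B : List.tabulate (representative B) ⊆ₗ members B
      reps⊆B r∈ with i , refl ← ∈-tabulate⁻ r∈ = ∈-members⁺ B (proj₁ (representative-spec B-tr i))

  module _ (P : Partition n) (Q-tr⇒P-tr : ∀ {B} → Transversal Q B → Transversal P B) where

    private
      through : Fin n → Fin (size Q) → Fin n
      through = section-through some-section

      through-transversal : ∀ a → Transversal P (image (through a))
      through-transversal a =
        Q-tr⇒P-tr (image-transversal (section-through-section some-section-section a))

      ∈-image-through : ∀ a → a ∈ image (through a)
      ∈-image-through a = ∈-image⁺ (through a) (section-through-at some-section a)

    transversals⇒sameQ⇒sameP : ∀ {u v} → label Q u ≡ label Q v → label P u ≡ label P v
    transversals⇒sameQ⇒sameP {u} {v} Qu≡Qv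
      with w , w∈Bv , Pw≡Pu ← proj₁ (through-transversal v) (label P u) | w ≟ v
    ... | yes refl = ≡.sym Pw≡Pu
    ... | no  w≢v  = ⊥-elim (Qw≢Qu (cong (label Q) w≡u))
      where
      Qw≢Qv : label Q w ≢ label Q v
      Qw≢Qv Qw≡Qv = w≢v (≡.trans (≡.sym (∈-image⁻ (through v) w∈Bv))
                          (≡.trans (cong (through v) Qw≡Qv) (section-through-at some-section v)))
      Qw≢Qu : label Q w ≢ label Q u
      Qw≢Qu Qw≡Qu = Qw≢Qv (≡.trans Qw≡Qu Qu≡Qv)
      w∈Bu : w ∈ image (through u)
      w∈Bu = ∈-image⁺ (through u) (begin
        through u (label Q w)    ≡⟨ section-through-off some-section u Qw≢Qu ⟩
        some-section (label Q w) ≡⟨ section-through-off some-section v Qw≢Qv ⟨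
        through v (label Q w)    ≡⟨ ∈-image⁻ (through v) w∈Bv ⟩
        w                        ∎)
        where open ≡.≡-Reasoning
      w≡u : w ≡ u
      w≡u = proj₂ (through-transversal u) w u w∈Bu (∈-image-through u) Pw≡Pu

    transversals⇒sameP⇒sameQ : ∀ {u v} → label P u ≡ label P v → label Q u ≡ label Q v
    transversals⇒sameP⇒sameQ {u} {v} Pu≡Pv with label Q u ≟ label Q v
    ... | yes Qu≡Qv = Qu≡Qv
    ... | no  Qu≢Qv = cong (label Q) (proj₂ (Q-tr⇒P-tr (image-transversal σ-sec)) u v u∈ v∈ Pu≡Pv)
      where
      σ = section-through (through u) v
      σ-sec = section-through-section (section-through-section some-section-section u) v
      v∈ = ∈-image⁺ σ (section-through-at (through u) v)
      u∈ = ∈-image⁺ σ (≡.trans (section-through-off (through u) v Qu≢Qv) (section-through-at some-section u))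

    transversals⇒sameBlocks : SameBlocks Q P
    transversals⇒sameBlocks u v = mk⇔ transversals⇒sameQ⇒sameP transversals⇒sameP⇒sameQ

module _ {n} (P : Partition n) {σ τ} (σ-sec : IsSection P σ) (τ-sec : IsSection P τ) where

  differsOnlyAt⇒tokenJump : ∀ i → σ i ≢ τ i → AgreeOff σ τ i →
                            TokenJump (image P σ) (image P τ) (σ i) (τ i)
  differsOnlyAt⇒tokenJump i σi≢τi agree =
    section∈image P σ-sec i ,
    (λ σi∈ → σi≢τi (≡.sym (≡.trans (cong τ (≡.sym (σ-sec i))) (∈-image⁻ P τ σi∈)))) ,
    section∈image P τ-sec i ,
    (λ τi∈ → σi≢τi (≡.trans (cong σ (≡.sym (τ-sec i))) (∈-image⁻ P σ τi∈))) ,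
    ⊆-antisym (image-minus-⊆ P τ-sec i agree) (image-minus-⊆ P σ-sec i (λ j j≢i → ≡.sym (agree j j≢i)))

  tokenJump⇒differsOnlyAt : ∀ {v₁ v₂} → TokenJump (image P σ) (image P τ) v₁ v₂ →
                            ∃[ i ] (σ i ≡ v₁ × τ i ≡ v₂ × AgreeOff σ τ i)
  tokenJump⇒differsOnlyAt {v₁} {v₂} (v₁∈ , v₁∉ , v₂∈ , v₂∉ , S₁-v₁≡S₂-v₂) =
    i , ∈-image⁻ P σ v₁∈ , τi≡v₂ , agree
    where
    i = label P v₁
    agree : AgreeOff σ τ i
    agree j j≢i = ≡.sym (≡.trans (cong τ (≡.sym (σ-sec j))) (∈-image⁻ P τ σj∈S₂))
      where
      σj≢v₁ : σ j ≢ v₁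
      σj≢v₁ σj≡v₁ = j≢i (≡.trans (≡.sym (σ-sec j)) (cong (label P) σj≡v₁))
      σj∈S₂ = x∈p-y⇒x∈p (subst (σ j ∈_) S₁-v₁≡S₂-v₂ (x∈p∧x≢y⇒x∈p-y (section∈image P σ-sec j) σj≢v₁))
    lv₂≡i : label P v₂ ≡ i
    lv₂≡i with label P v₂ ≟ i
    ... | yes lv₂≡i = lv₂≡i
    ... | no  lv₂≢i = ⊥-elim (v₂∉ (∈-image⁺ P σ (≡.trans (agree _ lv₂≢i) (∈-image⁻ P τ v₂∈))))
    τi≡v₂ = ≡.trans (cong τ (≡.sym lv₂≡i)) (∈-image⁻ P τ v₂∈)

  jump⇔differsAtOne : (∃[ v₁ ] ∃[ v₂ ] TokenJump (image P σ) (image P τ) v₁ v₂) ⇔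
                      (∃[ i ] (σ i ≢ τ i × AgreeOff σ τ i))
  jump⇔differsAtOne = mk⇔ to (λ (i , σi≢τi , agree) → σ i , τ i , differsOnlyAt⇒tokenJump i σi≢τi agree)
    where
    to : (∃[ v₁ ] ∃[ v₂ ] TokenJump (image P σ) (image P τ) v₁ v₂) →
         ∃[ i ] (σ i ≢ τ i × AgreeOff σ τ i)
    to (v₁ , v₂ , jump@(_ , v₁∉ , v₂∈ , _))
      with i , refl , refl , agree ← tokenJump⇒differsOnlyAt jump
      = i , (λ σi≡τi → v₁∉ (subst (_∈ image P τ) (≡.sym σi≡τi) v₂∈)) , agree

  slide⇔adjacentAtOne : ∀ {R : Fin n → Fin n → Set} → (∀ {v} → ¬ R v v) →
    (∃[ v₁ ] ∃[ v₂ ] (TokenJump (image P σ) (image P τ) v₁ v₂ × R v₁ v₂)) ⇔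
    (∃[ i ] (R (σ i) (τ i) × AgreeOff σ τ i))
  slide⇔adjacentAtOne {R} R-irrefl = mk⇔ to from
    where
    to : (∃[ v₁ ] ∃[ v₂ ] (TokenJump (image P σ) (image P τ) v₁ v₂ × R v₁ v₂)) →
         ∃[ i ] (R (σ i) (τ i) × AgreeOff σ τ i)
    to (v₁ , v₂ , jump , v₁Rv₂) with i , refl , refl , agree ← tokenJump⇒differsOnlyAt jump = i , v₁Rv₂ , agree
    from : ∃[ i ] (R (σ i) (τ i) × AgreeOff σ τ i) →
           ∃[ v₁ ] ∃[ v₂ ] (TokenJump (image P σ) (image P τ) v₁ v₂ × R v₁ v₂)
    from (i , σiRτi , agree) = σ i , τ i , differsOnlyAt⇒tokenJump i σi≢τi agree , σiRτi
      where
      σi≢τi : σ i ≢ τ i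
      σi≢τi σi≡τi = R-irrefl (subst (R (σ i)) (≡.sym σi≡τi) σiRτi)

module Reconfiguration (G : Graph) (x : PartitionProperty G) (P : Partition (n G)) (hP : holds x P) where

  private
    k = size P

  -- TE and TS are the instances for their two edge relations.
  TransversalGraph : (Subset (n G) → Subset (n G) → Set) → PGraph
  TransversalGraph E = record { Carrier = Subset (n G) ; Vert = TVert G x k ; Edge = E }

  transversal⇒vertex : ∀ {B} → Transversal P B → TVert G x k B
  transversal⇒vertex B-tr = transversal-size P B-tr , P , hP , B-tr

  module _ (unique : UniqueOptimal x P) where

    vertex⇒transversal : ∀ {B} → TVert G x k B → Transversal P B
    vertex⇒transversal (|B|≡k , Q , hQ , B-trQ) =
      sameBlocks-transversal Q P (unique Q hQ (≡.trans (≡.sym (transversal-size Q B-trQ)) |B|≡k)) B-trQ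

    ≅-BlockProduct : ∀ {E} H →
      (∀ {σ τ} → IsSection P σ → IsSection P τ →
         E (image P σ) (image P τ) ⇔ (∃[ i ] (H i (σ i) (τ i) × AgreeOff σ τ i))) →
      TransversalGraph E ≅ BlockProduct P H
    ≅-BlockProduct {E} H edge⇔ = record
      { to        = representatives P
      ; from      = image P ∘ lookup
      ; to-vert   = λ B B-vert → representatives-section P (vertex⇒transversal B-vert)
      ; from-vert = λ t t-sec → transversal⇒vertex (image-transversal P t-sec)
      ; from-to   = λ B B-vert → image-representatives P (vertex⇒transversal B-vert)
      ; to-from   = λ t → representatives-image P
      ; edge      = λ B B' B-vert B'-vert → edge (vertex⇒transversal B-vert) (vertex⇒transversal B'-vert)
      }
      where
      edge : ∀ {B B'} → Transversal P B → Transversal P B' →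
             E B B' ⇔ Edge (BlockProduct P H) (representatives P B) (representatives P B')
      edge {B} {B'} B-tr B'-tr =
        subst₂ (λ C C' → E C C' ⇔ Edge (BlockProduct P H) (representatives P B) (representatives P B'))
               (image-representatives P B-tr) (image-representatives P B'-tr)
               (edge⇔ (representatives-section P B-tr) (representatives-section P B'-tr))

  module _ (F : Subset (n G) → Vec (Fin (n G)) k)
           (F-section : ∀ {B} → TVert G x k B → IsSection P (lookup (F B)))
           (F-injective : InjectiveOn F (TVert G x k)) where

    private
      retract : Subset (n G) → Subset (n G)
      retract B = image P (lookup (F B))

      retract-injective : InjectiveOn retract (TVert G x k)
      retract-injective {B} {B'} B-vert B'-vert rB≡rB' = F-injective B-vert B'-vert (begin
        F B                            ≡⟨ representatives-image P (F-section B-vert) ⟨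
        representatives P (retract B)  ≡⟨ cong (representatives P) rB≡rB' ⟩
        representatives P (retract B') ≡⟨ representatives-image P (F-section B'-vert) ⟩
        F B'                           ∎)
        where open ≡.≡-Reasoning

      retract-transversal : ∀ {B} → TVert G x k B → retract B ∈ₗ transversals P
      retract-transversal B-vert = ∈-transversals⁺ P (image-transversal P (F-section B-vert))

      transversal-vertex : ∀ {B} → B ∈ₗ transversals P → TVert G x k B
      transversal-vertex = transversal⇒vertex ∘ ∈-transversals⁻ P

    injection⇒vertex⇒transversal : ∀ {B} → TVert G x k B → Transversal P B
    injection⇒vertex⇒transversal B-vert
      with B₀ , B₀∈ , rB≡rB₀ ← ∈-map⁻ retract (injectiveOn⇒surjectiveOn (≡-dec Bool._≟_)
             (transversals-Unique P)
             (retract-transversal ∘ transversal-vertex)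
             (λ B∈ B'∈ → retract-injective (transversal-vertex B∈) (transversal-vertex B'∈))
             (retract-transversal B-vert))
      = subst (Transversal P) (≡.sym (retract-injective B-vert (transversal-vertex B₀∈) rB≡rB₀))
              (∈-transversals⁻ P B₀∈)

    injection⇒uniqueOptimal : UniqueOptimal x P
    injection⇒uniqueOptimal Q hQ |Q|≡|P| = transversals⇒sameBlocks Q P
      (λ B-tr → injection⇒vertex⇒transversal (≡.trans (transversal-size Q B-tr) |Q|≡|P| , Q , hQ , B-tr))

  ≅⇒uniqueOptimal : ∀ {E} H → TransversalGraph E ≅ BlockProduct P H → UniqueOptimal x P
  ≅⇒uniqueOptimal H iso = injection⇒uniqueOptimal (_≅_.to iso) (_≅_.to-vert iso _) (≅-injective iso)

optimal⇒holds : ∀ {G} mode (x : PartitionProperty G) {P} → Optimal mode x P → holds x P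
optimal⇒holds maxParam x = proj₁
optimal⇒holds minParam x = proj₁

mainTheorem5 : (G : Graph) (mode : MaxMin) (x : PartitionProperty G)
               (𝒴 : Partition (n G)) → Optimal mode x 𝒴 →
               ((TE G x (size 𝒴) ≅ ProdComplete 𝒴) ⇔ UniqueOptimal x 𝒴) ×
               ((TS G x (size 𝒴) ≅ ProdInduced G 𝒴) ⇔ UniqueOptimal x 𝒴)
mainTheorem5 G mode x 𝒴 opt =
  mk⇔ (≅⇒uniqueOptimal distinct) (λ unique → ≅-BlockProduct unique distinct (jump⇔differsAtOne 𝒴)) ,
  mk⇔ (≅⇒uniqueOptimal adjacent)
      (λ unique → ≅-BlockProduct unique adjacent (λ σ-sec τ-sec → slide⇔adjacentAtOne 𝒴 σ-sec τ-sec (irrefl G)))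
  where
  open Reconfiguration G x 𝒴 (optimal⇒holds mode x opt)
  distinct adjacent : Fin (size 𝒴) → Fin (n G) → Fin (n G) → Set
  distinct _ a b = a ≢ b
  adjacent _ = Adj G
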